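{- Let $q\ge 2$ and $n\ge 1$ be natural numbers and $\Sigma=\{0,1,\dots,q-1\}$. There are exactly $q^n$ words of length $2^n-1$ over $\Sigma$ which are $Z_n$-instances.
   Context: Zimin words are indexed so that $Z_n$ has length $2^n-1$: $Z_1=x_1$ (a single letter), and $Z_{k+1}=Z_k\,x_{k+1}\,Z_k$, where $x_1,x_2,\dots$ are distinct letters (so $Z_2=x_1x_2x_1$, $Z_3=x_1x_2x_1x_3x_1x_2x_1$). A word $W$ over $\Sigma$ is an instance of a word $V$ (a $V$-instance) if there is a non-erasing monoid homomorphism $\phi$ from words over the letters of $V$ to $\Sigma^+$ (i.e., every letter is sent to a nonempty word) with $\phi(V)=W$. -}

module Defs where

open import Data.Nat using (ℕ; zero; suc; _∸_; _^_)
open import Data.Fin using (Fin; inject₁; fromℕ)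
open import Data.List using (List; []; _∷_; _++_; map; concatMap)
open import Data.List.NonEmpty using (List⁺; toList)
open import Data.Vec using (Vec; toList)
open import Data.Product using (∃)
open import Relation.Binary.PropositionalEquality using (_≡_)

-- Zimin word Z_(suc k) over the alphabet of letters Fin (suc k)
-- (letter i stands for x_(i+1)); length 2^(suc k) - 1.
-- Z_1 = x_1 ; Z_(k+1) = Z_k x_(k+1) Z_k
Zimin : (k : ℕ) → List (Fin (suc k))
Zimin zero = fromℕ zero ∷ []
Zimin (suc k) = map inject₁ (Zimin k) ++ (fromℕ (suc k) ∷ map inject₁ (Zimin k))

applyMorph : {A B : Set} → (A → List⁺ B) → List A → List B
applyMorph φ = concatMap (λ a → Data.List.NonEmpty.toList (φ a))

IsInstance : {A B : Set} → List A → List B → Set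
IsInstance {A} {B} V W = ∃ λ (φ : A → List⁺ B) → applyMorph φ V ≡ W

WordOfLen : ℕ → ℕ → Set
WordOfLen q n = Vec (Fin q) (2 ^ n ∸ 1)

IsZiminInstance : (q k : ℕ) → WordOfLen q (suc k) → Set
IsZiminInstance q k w = IsInstance (Zimin k) (Data.Vec.toList w)

module Submission where

-- A Z_n-instance W = φ(Z_n) of length 2^n - 1 = |Z_n| must come
-- from a morphism φ sending every letter to a single letter: a non-erasing
-- morphism never shortens a word, and it preserves the length only if each
-- image is a one-letter word.  Hence the Z_n-instances of that length are
-- exactly the words  substitute σ = σ(Z_n)  for letter maps σ : Fin n → Σ.
-- Since every letter x_1 … x_n occurs in Z_n, the word σ(Z_n) determines σ
-- pointwise.  Letter maps Fin n → Fin q are in turn enumerated by Fin (q ^ n)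
-- through the library's  finToFun / funToFin  (base-q digits).

open import Defs
open import Data.Nat using (ℕ; zero; suc; _+_; _^_; _∸_; _≤_; _≥_; z≤n; s≤s)
open import Data.Nat.Properties
  using (≤-trans; ≤-reflexive; n≮n; suc-injective; +-identityʳ)
open import Data.Fin using (Fin; zero; suc; inject₁; fromℕ; combine; finToFun; funToFin)
open import Data.Fin.Properties using (funToFin-finToFin; finToFun-funToFin)
open import Data.List using (List; []; _∷_; _++_; map; length; [_])
open import Data.List.Properties
  using (∷-injectiveˡ; ∷-injectiveʳ; length-++; length-++-≤ʳ; length-map; concatMap-map; concatMap-pure)
open import Data.List.NonEmpty using (List⁺; _∷_; head)
open import Data.List.Membership.Propositional using (_∈_)
open import Data.List.Membership.Propositional.Properties using (∈-++⁺ˡ; ∈-++⁺ʳ; ∈-map⁺)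
open import Data.List.Relation.Unary.Any using (here; there)
open import Data.Vec using (Vec; toList; fromList; cast)
import Data.Vec as Vec
open import Data.Vec.Properties using (cast-is-id; toList-injective; toList-map; toList-cast; toList∘fromList)
import Data.Vec.Properties as Vec
open import Data.Product using (Σ; ∃; _×_; _,_)
open import Data.Sum using (_⊎_; inj₁; inj₂)
open import Data.Empty using (⊥-elim)
open import Function using (_∘_)
open import Function.Definitions using (Injective)
open import Relation.Binary.PropositionalEquality
  using (_≡_; _≗_; refl; sym; trans; cong; cong₂; module ≡-Reasoning)

module _ {A B : Set} where

  length-applyMorph-≥ : (φ : A → List⁺ B) (xs : List A) →
                        length xs ≤ length (applyMorph φ xs)
  length-applyMorph-≥ φ [] = z≤n
  length-applyMorph-≥ φ (a ∷ xs) with φ a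
  ... | b ∷ bs = s≤s (≤-trans (length-applyMorph-≥ φ xs) (length-++-≤ʳ _ {bs}))

  applyMorph-length-preserving : (φ : A → List⁺ B) (xs : List A) →
    length (applyMorph φ xs) ≡ length xs → applyMorph φ xs ≡ map (head ∘ φ) xs
  applyMorph-length-preserving φ [] _ = refl
  applyMorph-length-preserving φ (a ∷ xs) same with φ a
  ... | b ∷ [] = cong (b ∷_) (applyMorph-length-preserving φ xs (suc-injective same))
  ... | b ∷ c ∷ cs = ⊥-elim (n≮n _ tooLong)
    where
    -- |xs| would be 1 + |cs ++ φ(xs)|, yet φ(xs) is already at least as long as xs
    tooLong : suc (length (cs ++ applyMorph φ xs)) ≤ length (cs ++ applyMorph φ xs)
    tooLong = ≤-trans (≤-reflexive (suc-injective same))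
              (≤-trans (length-applyMorph-≥ φ xs) (length-++-≤ʳ _ {cs}))

  letterMorph : (A → B) → A → List⁺ B
  letterMorph f a = f a ∷ []

  applyMorph-letterMorph : (f : A → B) → applyMorph (letterMorph f) ≗ map f
  applyMorph-letterMorph f xs =
    trans (sym (concatMap-map [_] f xs)) (concatMap-pure (map f xs))

map-≡⇒agree-on-∈ : {A B : Set} {f g : A → B} {x : A} (xs : List A) →
                   map f xs ≡ map g xs → x ∈ xs → f x ≡ g x
map-≡⇒agree-on-∈ (_ ∷ _)  same (here refl)  = ∷-injectiveˡ same
map-≡⇒agree-on-∈ (_ ∷ xs) same (there x∈xs) = map-≡⇒agree-on-∈ xs (∷-injectiveʳ same) x∈xs

funToFin-cong : {m n : ℕ} {f g : Fin m → Fin n} → f ≗ g → funToFin f ≡ funToFin g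
funToFin-cong {zero}  f≗g = refl
funToFin-cong {suc m} f≗g = cong₂ combine (f≗g zero) (funToFin-cong (f≗g ∘ suc))

fromℕ-or-inject₁ : (n : ℕ) (j : Fin (suc n)) → j ≡ fromℕ n ⊎ ∃ λ i → j ≡ inject₁ i
fromℕ-or-inject₁ zero    zero    = inj₁ refl
fromℕ-or-inject₁ (suc n) zero    = inj₂ (zero , refl)
fromℕ-or-inject₁ (suc n) (suc j) with fromℕ-or-inject₁ n j
... | inj₁ j≡top      = inj₁ (cong suc j≡top)
... | inj₂ (i , j≡i) = inj₂ (suc i , cong suc j≡i)

suc-length-Zimin : (k : ℕ) → suc (length (Zimin k)) ≡ 2 ^ suc k
suc-length-Zimin zero    = refl
suc-length-Zimin (suc k) = begin
  suc (length (map inject₁ Z ++ fromℕ (suc k) ∷ map inject₁ Z))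
    ≡⟨ cong suc (length-++ (map inject₁ Z)) ⟩
  suc (length (map inject₁ Z) + suc (length (map inject₁ Z)))
    ≡⟨ cong (λ n → suc (n + suc n)) (length-map inject₁ Z) ⟩
  suc (length Z) + suc (length Z)
    ≡⟨ cong₂ _+_ (suc-length-Zimin k) (trans (suc-length-Zimin k) (sym (+-identityʳ _))) ⟩
  2 ^ suc (suc k)
    ∎
  where
  open ≡-Reasoning
  Z : List (Fin (suc k))
  Z = Zimin k

length-Zimin : (k : ℕ) → length (Zimin k) ≡ 2 ^ suc k ∸ 1
length-Zimin k = cong (_∸ 1) (suc-length-Zimin k)

Zimin-complete : (k : ℕ) (j : Fin (suc k)) → j ∈ Zimin k
Zimin-complete zero    zero = here refl
Zimin-complete (suc k) j with fromℕ-or-inject₁ (suc k) j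
... | inj₁ refl       = ∈-++⁺ʳ (map inject₁ (Zimin k)) (here refl)
... | inj₂ (i , refl) = ∈-++⁺ˡ (∈-map⁺ inject₁ (Zimin-complete k i))

ziminVec : (k : ℕ) → Vec (Fin (suc k)) (2 ^ suc k ∸ 1)
ziminVec k = cast (length-Zimin k) (fromList (Zimin k))

substitute : {q : ℕ} (k : ℕ) → (Fin (suc k) → Fin q) → WordOfLen q (suc k)
substitute k σ = Vec.map σ (ziminVec k)

toList-substitute : {q : ℕ} (k : ℕ) (σ : Fin (suc k) → Fin q) →
                    toList (substitute k σ) ≡ map σ (Zimin k)
toList-substitute k σ = begin
  toList (Vec.map σ (ziminVec k))
    ≡⟨ toList-map σ (ziminVec k) ⟩
  map σ (toList (ziminVec k))
    ≡⟨ cong (map σ) (toList-cast (length-Zimin k) (fromList (Zimin k))) ⟩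
  map σ (toList (fromList (Zimin k)))
    ≡⟨ cong (map σ) (toList∘fromList (Zimin k)) ⟩
  map σ (Zimin k)
    ∎
  where open ≡-Reasoning

substitute-isInstance : {q : ℕ} (k : ℕ) (σ : Fin (suc k) → Fin q) →
                        IsZiminInstance q k (substitute k σ)
substitute-isInstance k σ =
  letterMorph σ , trans (applyMorph-letterMorph σ (Zimin k)) (sym (toList-substitute k σ))

substitute-determines : {q : ℕ} (k : ℕ) {σ τ : Fin (suc k) → Fin q} →
                        substitute k σ ≡ substitute k τ → σ ≗ τ
substitute-determines k {σ} {τ} same j = map-≡⇒agree-on-∈ (Zimin k) sameLists (Zimin-complete k j)
  where
  sameLists : map σ (Zimin k) ≡ map τ (Zimin k)
  sameLists = trans (sym (toList-substitute k σ))
              (trans (cong toList same) (toList-substitute k τ))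

instance-isSubstitution : {q : ℕ} (k : ℕ) (w : WordOfLen q (suc k)) →
                          IsZiminInstance q k w → ∃ λ σ → substitute k σ ≡ w
instance-isSubstitution k w (φ , φZ≡w) =
  head ∘ φ ,
  trans (sym (cast-is-id refl _)) (toList-injective refl (substitute k (head ∘ φ)) w (begin
    toList (substitute k (head ∘ φ)) ≡⟨ toList-substitute k (head ∘ φ) ⟩
    map (head ∘ φ) (Zimin k)         ≡⟨ sym (applyMorph-length-preserving φ (Zimin k) sameLength) ⟩
    applyMorph φ (Zimin k)           ≡⟨ φZ≡w ⟩
    toList w                         ∎))
  where
  open ≡-Reasoning
  sameLength : length (applyMorph φ (Zimin k)) ≡ length (Zimin k)
  sameLength = trans (cong length φZ≡w) (trans (Vec.length-toList w) (sym (length-Zimin k)))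

-- The Z_n-instances of length 2^n - 1 over Fin q are enumerated without
-- repetition by Fin (q ^ n): the i-th one substitutes the digits of i.
-- (The argument does not need the hypothesis q ≥ 2.)
lemma1 : (q k : ℕ) → q ≥ 2 →
    Σ (Fin (q ^ suc k) → WordOfLen q (suc k)) λ f →
      Injective _≡_ _≡_ f
      × ((i : Fin (q ^ suc k)) → IsZiminInstance q k (f i))
      × ((w : WordOfLen q (suc k)) → IsZiminInstance q k w → ∃ λ i → f i ≡ w)
lemma1 q k _ = enumerate , enumerate-injective , isInstance , covers
  where
  digits : Fin (q ^ suc k) → Fin (suc k) → Fin q
  digits = finToFun

  enumerate : Fin (q ^ suc k) → WordOfLen q (suc k)
  enumerate i = substitute k (digits i)

  enumerate-injective : Injective _≡_ _≡_ enumerate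
  enumerate-injective {i} {j} same = begin
    i                       ≡⟨ sym (funToFin-finToFin {suc k} {q} i) ⟩
    funToFin (digits i)     ≡⟨ funToFin-cong (substitute-determines k same) ⟩
    funToFin (digits j)     ≡⟨ funToFin-finToFin {suc k} {q} j ⟩
    j                       ∎
    where open ≡-Reasoning

  isInstance : (i : Fin (q ^ suc k)) → IsZiminInstance q k (enumerate i)
  isInstance i = substitute-isInstance k (digits i)

  covers : (w : WordOfLen q (suc k)) → IsZiminInstance q k w → ∃ λ i → enumerate i ≡ w
  covers w inst with instance-isSubstitution k w inst
  ... | σ , σZ≡w =
    funToFin σ , trans (Vec.map-cong (finToFun-funToFin σ) (ziminVec k)) σZ≡w
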